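{- In Ruleset A, a superposition of single Nim heaps whose largest heap has size $k\ge1$ has value $*(k-1)$, i.e. $\langle \mathrm{Nim}(i_1),\dots,\mathrm{Nim}(i_\ell)\rangle_A\equiv *(k-1)$ where $k=\max_{1\le j\le\ell} i_j\ge 1$.
   Context: $\mathrm{Nim}(x)$ is a single Nim heap of $x$ tokens; a classical move $(1,-j)$, $j\ge1$, removes $j$ tokens and is legal iff $x\ge j$. Quantum variation: a quantum position is a finite nonempty set $\langle G_1,\dots,G_n\rangle$ of classical positions (multiplicities irrelevant). A classical move is legal in it if legal in at least one $G_i$. A Q-move is a finite nonempty set of classical moves, each legal in the current quantum position; it leads to the set of all positions obtained by applying one of its moves to one of the $G_i$ where that move is legal. Ruleset A (subscript $A$): only Q-moves containing at least two distinct classical moves are allowed. Normal convention: a player with no allowed Q-move loses. $*n$ denotes the value (equivalence class under $G\equiv H$ iff $G+X$, $H+X$ have the same outcome for all games $X$) of a classical Nim heap of $n$ tokens, with $*0=0$. -}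

module Defs where

open import Data.Nat using (ℕ; zero; suc; _⊔_; _∸_; _≤ᵇ_; _≤?_)
open import Data.Fin using (Fin; zero; suc; splitAt)
open import Data.Bool using (Bool; true; false; not; _∨_; if_then_else_)
open import Data.Sum using ([_,_]′)
open import Data.List using (List; []; _∷_; _++_; map; concatMap; foldr; length; filter; lookup)
open import Relation.Binary.PropositionalEquality using (_≡_)

-- Impartial (short) games as finitely branching game trees.

data Game : Set where
  node : (n : ℕ) → (Fin n → Game) → Game

anyFin : (n : ℕ) → (Fin n → Bool) → Bool
anyFin zero    f = false
anyFin (suc n) f = f zero ∨ anyFin n (λ i → f (suc i))

nextWins : Game → Bool
nextWins (node n f) = anyFin n (λ i → not (nextWins (f i)))

_+G_ : Game → Game → Game
node n f +G node m g =
  node (n Data.Nat.+ m)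
       (λ i → [ (λ a → f a +G node m g) , (λ b → node n f +G g b) ]′ (splitAt n i))

_≈G_ : Game → Game → Set
G ≈G H = (X : Game) → nextWins (G +G X) ≡ nextWins (H +G X)

mutual
  nim : ℕ → Game
  nim n = node n (nimOpts n)

  nimOpts : (n : ℕ) → Fin n → Game
  nimOpts (suc n) zero    = nim n
  nimOpts (suc n) (suc i) = nimOpts n i

-- A quantum position of single Nim heaps, given by the list of heap sizes
-- (order and multiplicities irrelevant).
maxL : List ℕ → ℕ
maxL = foldr _⊔_ 0

subsets : ℕ → List (List ℕ)
subsets zero    = [] ∷ []
subsets (suc n) = subsets n ++ map (suc n ∷_) (subsets n)

-- Ruleset A Q-moves in a position whose largest heap is M: sets of at
-- least two distinct classical moves "remove j", each legal (1 ≤ j ≤ M).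
qmovesA : ℕ → List (List ℕ)
qmovesA M = filter (λ S → 2 ≤? length S) (subsets M)

applyQ : List ℕ → List ℕ → List ℕ
applyQ S ps = concatMap (λ j → concatMap (λ x → if j ≤ᵇ x then (x ∸ j) ∷ [] else []) ps) S

-- Game tree of a quantum position all of whose heaps are ≤ b.
-- (Every move decreases every heap by ≥ 1, so b suffices as depth.)
qgameA : ℕ → List ℕ → Game
qgameA zero    ps = node 0 (λ ())
qgameA (suc b) ps =
  node (length (qmovesA (maxL ps)))
       (λ i → qgameA b (applyQ (lookup (qmovesA (maxL ps)) i) ps))

QNimA : List ℕ → Game
QNimA ps = qgameA (maxL ps) ps

module Submission where

-- The proof goes through Grundy values, in two independent halves.
--
-- The Sprague–Grundy equivalence `grundy-equiv` shows that games with the same Grundy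
-- value are equivalent: a win of G + X transfers to H + X, by a mutual recursion on the
-- two Grundy witnesses and the context X (a winning move in X is answered in X; a move
-- G → G′ to a smaller value is mirrored in H; a move to a larger value is undone inside
-- G′).
--
-- For a position ps with largest heap M, every Ruleset A move leads to a
-- position whose largest heap lies in [1, M) (a Q-move contains some j < M, which turns
-- the top heap into M ∸ j ≥ 1), and every c ∈ [1, M) is attained, by the move {M, M ∸ c}.
-- By induction on the game tree, ⟨ps⟩_A therefore has Grundy value M ∸ 1
-- (`qgameA-grundy`), and the theorem follows from `grundy-equiv`.

open import Defs
open import Data.Nat using (ℕ; zero; suc; _+_; _∸_; _≤_; _<_; _≤ᵇ_; _≤?_; z≤n; s≤s)
open import Data.Nat.Properties
open import Data.Nat.Induction using (<-rec)
open import Data.Fin using (Fin; zero; suc; splitAt; _↑ˡ_; _↑ʳ_)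
open import Data.Fin.Properties using (splitAt-↑ˡ; splitAt-↑ʳ)
open import Data.Bool using (Bool; true; false; not; _∨_; if_then_else_)
open import Data.Bool.Properties using (∨-zeroʳ; ¬-not; ⇔→≡)
open import Data.List using (List; []; _∷_; length; concatMap; lookup)
open import Data.List.Relation.Unary.Any using (here; there; index)
open import Data.List.Relation.Unary.Any.Properties using (lookup-index)
open import Data.List.Membership.Propositional using (_∈_; find; lose)
open import Data.List.Membership.Propositional.Properties
  using (∈-concatMap⁺; ∈-concatMap⁻; ∈-++⁺ˡ; ∈-++⁺ʳ; ∈-++⁻; ∈-map⁺; ∈-map⁻;
         ∈-filter⁺; ∈-filter⁻; ∈-lookup)
open import Data.Product using (Σ; ∃; ∃₂; _×_; _,_; proj₁; proj₂; map; map₁; map₂)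
open import Data.Sum using (_⊎_; inj₁; inj₂; [_,_]′)
open import Function using (_∘_; _∘′_; id)
open import Function.Bundles using (mk⇔)
open import Relation.Binary using (Tri; tri<; tri≈; tri>)
open import Relation.Binary.PropositionalEquality using (_≡_; _≢_; refl; sym; trans; cong; subst)
open import Relation.Nullary using (¬_; contradiction)

Win : Game → Set
Win G = nextWins G ≡ true

anyFin-intro : ∀ n (p : Fin n → Bool) (i : Fin n) → p i ≡ true → anyFin n p ≡ true
anyFin-intro (suc n) p zero    pi≡true = cong (_∨ anyFin n (p ∘ suc)) pi≡true
anyFin-intro (suc n) p (suc i) pi≡true =
  trans (cong (p zero ∨_) (anyFin-intro n (p ∘ suc) i pi≡true)) (∨-zeroʳ (p zero))

anyFin-elim : ∀ n (p : Fin n → Bool) → anyFin n p ≡ true → Σ (Fin n) λ i → p i ≡ true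
anyFin-elim (suc n) p any≡true with p zero in p0
... | true  = zero , p0
... | false = map suc id (anyFin-elim n (p ∘ suc) any≡true)

win-intro : ∀ {n f} (i : Fin n) → ¬ Win (f i) → Win (node n f)
win-intro {n} i lost = anyFin-intro n _ i (cong not (¬-not lost))

win-elim : ∀ {n f} → Win (node n f) → Σ (Fin n) λ i → ¬ Win (f i)
win-elim {n} {f} w with anyFin-elim n _ w
... | i , not-wins = i , not-win
  where
  not-win : ¬ Win (f i)
  not-win wins with () ← trans (sym (cong not wins)) not-wins

win-stable : ∀ G → ¬ ¬ Win G → Win G
win-stable G ¬¬win with nextWins G
... | true  = refl
... | false = contradiction (λ ()) ¬¬win

sumOptions : ∀ {n m} → (Fin n → Game) → (Fin m → Game) → Fin (n + m) → Game
sumOptions {n} {m} f g i = [ (λ a → f a +G node m g) , (λ b → node n f +G g b) ]′ (splitAt n i)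

SumWinningMove : ∀ {n m} → (Fin n → Game) → (Fin m → Game) → Set
SumWinningMove {n} {m} f g =
  (Σ (Fin n) λ a → ¬ Win (f a +G node m g)) ⊎ (Σ (Fin m) λ b → ¬ Win (node n f +G g b))

module _ {n m : ℕ} {f : Fin n → Game} {g : Fin m → Game} where

  sumOptions-left : (a : Fin n) → sumOptions f g (a ↑ˡ m) ≡ f a +G node m g
  sumOptions-left a rewrite splitAt-↑ˡ n a m = refl

  sumOptions-right : (b : Fin m) → sumOptions f g (n ↑ʳ b) ≡ node n f +G g b
  sumOptions-right b rewrite splitAt-↑ʳ n m b = refl

  win-by-left : (a : Fin n) → ¬ Win (f a +G node m g) → Win (node n f +G node m g)
  win-by-left a lost =
    win-intro {f = sumOptions f g} (a ↑ˡ m) (subst (¬_ ∘ Win) (sym (sumOptions-left a)) lost)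

  win-by-right : (b : Fin m) → ¬ Win (node n f +G g b) → Win (node n f +G node m g)
  win-by-right b lost =
    win-intro {f = sumOptions f g} (n ↑ʳ b) (subst (¬_ ∘ Win) (sym (sumOptions-right b)) lost)

  win-elim-+G : Win (node n f +G node m g) → SumWinningMove f g
  win-elim-+G w with win-elim {f = sumOptions f g} w
  ... | i , lost with splitAt n i
  ...   | inj₁ a = inj₁ (a , lost)
  ...   | inj₂ b = inj₂ (b , lost)

data HasGrundy : Game → ℕ → Set where
  mex : ∀ {n f k}
      → ((i : Fin n) → Σ ℕ λ a → a ≢ k × HasGrundy (f i) a)
      → ((a : ℕ) → a < k → Σ (Fin n) λ i → HasGrundy (f i) a)
      → HasGrundy (node n f) k

mutual
  -- Games of equal Grundy value can replace each other in a won sum.  Every recursive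
  -- call shrinks one of the two Grundy witnesses (possibly swapping them) or the context.
  win-transfer : ∀ {G H k} → HasGrundy G k → HasGrundy H k → ∀ X → Win (G +G X) → Win (H +G X)
  win-transfer vG@(mex _ _) vH@(mex _ _) (node m g) w = win-by-winning-move vG vH (win-elim-+G w)

  -- Case split on the summand in which the winning move of G + X is played; a winning
  -- move X → X′ is answered by the same move in H + X.
  win-by-winning-move : ∀ {n f n′ f′ m g k} → HasGrundy (node n f) k → HasGrundy (node n′ f′) k →
                        SumWinningMove f g → Win (node n′ f′ +G node m g)
  win-by-winning-move {m = m} {g} {k} (mex opts _) vH (inj₁ (i , lost)) =
    let (a , a≢k , vG′) = opts i in win-after-move {m = m} {g} a≢k vG′ vH lost (<-cmp a k)
  win-by-winning-move {m = m} {g} vG vH (inj₂ (b , lost)) =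
    win-by-right {g = g} b (λ w → lost (win-transfer vH vG (g b) w))

  -- A winning move G → G′ to Grundy value a ≠ k: if a < k then H has an option of value
  -- a, which wins by the same token; if a > k then G′ has an option of value k, so
  -- G′ + X being lost makes that option plus X a win, hence H + X too.
  win-after-move : ∀ {G′ a k n′ f′ m g} → a ≢ k → HasGrundy G′ a → HasGrundy (node n′ f′) k →
                   ¬ Win (G′ +G node m g) → Tri (a < k) (a ≡ k) (k < a) →
                   Win (node n′ f′ +G node m g)
  win-after-move {m = m} {g} a≢k vG′ (mex _ reachH) lost (tri< a<k _ _) =
    let (j , vH′) = reachH _ a<k in
    win-by-left {g = g} j (λ w → lost (win-transfer vH′ vG′ (node m g) w))
  win-after-move a≢k _ _ _ (tri≈ _ a≡k _) = contradiction a≡k a≢k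
  win-after-move {m = m} {g} a≢k (mex {f = f} _ reachG′) vH lost (tri> _ _ k<a) =
    let (j , vG″) = reachG′ _ k<a in
    win-transfer vG″ vH (node m g)
      (win-stable (f j +G node m g) (λ lost′ → lost (win-by-left {g = g} j lost′)))

grundy-equiv : ∀ {G H k} → HasGrundy G k → HasGrundy H k → G ≈G H
grundy-equiv vG vH X = ⇔→≡ (mk⇔ (win-transfer vG vH X) (win-transfer vH vG X))

nimOpts-smaller : ∀ n (i : Fin n) → Σ ℕ λ a → a < n × nimOpts n i ≡ nim a
nimOpts-smaller (suc n) zero    = n , ≤-refl , refl
nimOpts-smaller (suc n) (suc i) = map₂ (map₁ m≤n⇒m≤1+n) (nimOpts-smaller n i)

nimOpts-every : ∀ n a → a < n → Σ (Fin n) λ i → nimOpts n i ≡ nim a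
nimOpts-every (suc n) a (s≤s a≤n) with m≤n⇒m<n∨m≡n a≤n
... | inj₂ refl = zero , refl
... | inj₁ a<n with nimOpts-every n a a<n
...   | i , opt≡nim = suc i , opt≡nim

nim-grundy : ∀ k → HasGrundy (nim k) k
nim-grundy = <-rec (λ k → HasGrundy (nim k) k) step
  where
  step : ∀ k → (∀ {a} → a < k → HasGrundy (nim a) a) → HasGrundy (nim k) k
  step k smaller = mex options reach
    where
    options : (i : Fin k) → Σ ℕ λ a → a ≢ k × HasGrundy (nimOpts k i) a
    options i with nimOpts-smaller k i
    ... | a , a<k , opt≡nim = a , <⇒≢ a<k , subst (λ G → HasGrundy G a) (sym opt≡nim) (smaller a<k)
    reach : (a : ℕ) → a < k → Σ (Fin k) λ i → HasGrundy (nimOpts k i) a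
    reach a a<k with nimOpts-every k a a<k
    ... | i , opt≡nim = i , subst (λ G → HasGrundy G a) (sym opt≡nim) (smaller a<k)

maxL-upper : ∀ {x xs} → x ∈ xs → x ≤ maxL xs
maxL-upper {xs = y ∷ ys} (here refl)  = m≤m⊔n y (maxL ys)
maxL-upper {xs = y ∷ ys} (there x∈ys) = m≤n⇒m≤o⊔n y (maxL-upper x∈ys)

maxL-least : ∀ {c} xs → (∀ {x} → x ∈ xs → x ≤ c) → maxL xs ≤ c
maxL-least []       bound = z≤n
maxL-least (x ∷ xs) bound = ⊔-lub (bound (here refl)) (maxL-least xs (bound ∘′ there))

maxL-member : ∀ xs → 0 < maxL xs → maxL xs ∈ xs
maxL-member (x ∷ xs) positive with ⊔-sel x (maxL xs)
... | inj₁ max≡x    = subst (_∈ x ∷ xs) (sym max≡x) (here refl)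
... | inj₂ max≡rest = subst (_∈ x ∷ xs) (sym max≡rest)
                        (there (maxL-member xs (subst (0 <_) max≡rest positive)))

removeFrom : ℕ → List ℕ → List ℕ
removeFrom j = concatMap (λ x → if j ≤ᵇ x then (x ∸ j) ∷ [] else [])

∈-applyQ⁺ : ∀ {S ps j x} → j ∈ S → x ∈ ps → j ≤ x → x ∸ j ∈ applyQ S ps
∈-applyQ⁺ {S} {ps} {j} {x} j∈S x∈ps j≤x =
  ∈-concatMap⁺ (λ j → removeFrom j ps) (lose j∈S (∈-concatMap⁺ _ (lose x∈ps legal)))
  where
  legal : x ∸ j ∈ (if j ≤ᵇ x then (x ∸ j) ∷ [] else [])
  legal with j ≤ᵇ x | ≤⇒≤ᵇ j≤x
  ... | true | _ = here refl

∈-applyQ⁻ : ∀ {S ps y} → y ∈ applyQ S ps → ∃₂ λ j x → j ∈ S × x ∈ ps × y ≡ x ∸ j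
∈-applyQ⁻ {S} {ps} y∈ with find (∈-concatMap⁻ (λ j → removeFrom j ps) {S} y∈)
... | j , j∈S , y∈removed with find (∈-concatMap⁻ _ {ps} y∈removed)
...   | x , x∈ps , y∈legal with j ≤ᵇ x | y∈legal
...     | true | here y≡x∸j = j , x , j∈S , x∈ps , y≡x∸j

applyQ-max-upper : ∀ {d} S ps → (∀ {j} → j ∈ S → d ≤ j) → maxL (applyQ S ps) ≤ maxL ps ∸ d
applyQ-max-upper {d} S ps removes = maxL-least (applyQ S ps) bound
  where
  bound : ∀ {y} → y ∈ applyQ S ps → y ≤ maxL ps ∸ d
  bound y∈ with ∈-applyQ⁻ {S} {ps} y∈
  ... | j , x , j∈S , x∈ps , refl = ∸-mono (maxL-upper x∈ps) (removes j∈S)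

applyQ-max-lower : ∀ {j} S ps → j ∈ S → j < maxL ps → maxL ps ∸ j ≤ maxL (applyQ S ps)
applyQ-max-lower S ps j∈S j<M =
  maxL-upper (∈-applyQ⁺ j∈S (maxL-member ps (≤-trans (s≤s z≤n) j<M)) (<⇒≤ j<M))

subsets-range : ∀ M {S j} → S ∈ subsets M → j ∈ S → 1 ≤ j × j ≤ M
subsets-range zero (here refl) ()
subsets-range (suc n) S∈ j∈S with ∈-++⁻ (subsets n) S∈
... | inj₁ S∈old = map₂ m≤n⇒m≤1+n (subsets-range n S∈old j∈S)
... | inj₂ S∈new with ∈-map⁻ (suc n ∷_) S∈new
...   | S′ , S′∈ , refl with j∈S
...     | here refl  = s≤s z≤n , ≤-refl
...     | there j∈S′ = map₂ m≤n⇒m≤1+n (subsets-range n S′∈ j∈S′)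

-- In a member of subsets M, the second element is below M (elements are listed in
-- decreasing order).
subsets-second-below : ∀ M {j j′ S} → (j ∷ j′ ∷ S) ∈ subsets M → j′ < M
subsets-second-below zero (there ())
subsets-second-below (suc n) S∈ with ∈-++⁻ (subsets n) S∈
... | inj₁ S∈old = s≤s (proj₂ (subsets-range n S∈old (there (here refl))))
... | inj₂ S∈new with ∈-map⁻ (suc n ∷_) S∈new
...   | S′ , S′∈ , refl = s≤s (proj₂ (subsets-range n S′∈ (here refl)))

[]-∈-subsets : ∀ M → [] ∈ subsets M
[]-∈-subsets zero    = here refl
[]-∈-subsets (suc n) = ∈-++⁺ˡ ([]-∈-subsets n)

singleton-∈-subsets : ∀ {M j} → 1 ≤ j → j ≤ M → (j ∷ []) ∈ subsets M
singleton-∈-subsets {zero}  (s≤s z≤n) ()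
singleton-∈-subsets {suc n} 1≤j j≤M with m≤n⇒m<n∨m≡n j≤M
... | inj₁ (s≤s j≤n) = ∈-++⁺ˡ (singleton-∈-subsets 1≤j j≤n)
... | inj₂ refl      = ∈-++⁺ʳ (subsets n) (∈-map⁺ (suc n ∷_) ([]-∈-subsets n))

∈-qmovesA⁻ : ∀ {M S} → S ∈ qmovesA M → S ∈ subsets M × 2 ≤ length S
∈-qmovesA⁻ {M} = ∈-filter⁻ (λ S → 2 ≤? length S) {xs = subsets M}

qmovesA-positive : ∀ {M S j} → S ∈ qmovesA M → j ∈ S → 1 ≤ j
qmovesA-positive {M} S∈ j∈S = proj₁ (subsets-range M (proj₁ (∈-qmovesA⁻ {M} S∈)) j∈S)

qmovesA-below-top : ∀ {M S} → S ∈ qmovesA M → ∃ λ j → j ∈ S × j < M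
qmovesA-below-top {M} {S} S∈ with ∈-qmovesA⁻ {M} S∈
qmovesA-below-top {M} {j ∷ j′ ∷ _} _ | S∈subsets , _ =
  j′ , there (here refl) , subsets-second-below M S∈subsets
qmovesA-below-top {S = _ ∷ []}     _ | _ , s≤s ()
qmovesA-below-top {S = []}         _ | _ , ()

top-pair-∈-qmovesA : ∀ {M j} → 1 ≤ j → j < M → (M ∷ j ∷ []) ∈ qmovesA M
top-pair-∈-qmovesA {suc n} 1≤j (s≤s j≤n) =
  ∈-filter⁺ _ (∈-++⁺ʳ (subsets n) (∈-map⁺ (suc n ∷_) (singleton-∈-subsets 1≤j j≤n)))
              (s≤s (s≤s z≤n))

qmoveA-max-range : ∀ {S} ps → S ∈ qmovesA (maxL ps) →
                   1 ≤ maxL (applyQ S ps) × maxL (applyQ S ps) < maxL ps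
qmoveA-max-range {S} ps S∈ with qmovesA-below-top {maxL ps} S∈
... | j , j∈S , j<M =
  ≤-trans (m<n⇒0<n∸m j<M) (applyQ-max-lower S ps j∈S j<M) ,
  ≤-<-trans (applyQ-max-upper S ps (qmovesA-positive {maxL ps} S∈))
            (∸-monoʳ-< (s≤s z≤n) (≤-trans (s≤s z≤n) j<M))

qmoveA-max-reach : ∀ ps {c} → 1 ≤ c → c < maxL ps →
                   maxL (applyQ (maxL ps ∷ (maxL ps ∸ c) ∷ []) ps) ≡ c
qmoveA-max-reach ps {c} 1≤c c<M = ≤-antisym upper lower
  where
  M = maxL ps
  S = M ∷ (M ∸ c) ∷ []
  removes-enough : ∀ {j} → j ∈ S → M ∸ c ≤ j
  removes-enough (here refl)         = m∸n≤m M c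
  removes-enough (there (here refl)) = ≤-refl
  upper : maxL (applyQ S ps) ≤ c
  upper = subst (maxL (applyQ S ps) ≤_) (m∸[m∸n]≡n (<⇒≤ c<M))
            (applyQ-max-upper S ps removes-enough)
  lower : c ≤ maxL (applyQ S ps)
  lower = subst (_≤ maxL (applyQ S ps)) (m∸[m∸n]≡n (<⇒≤ c<M))
            (applyQ-max-lower S ps (there (here refl)) (∸-monoʳ-< 1≤c (<⇒≤ c<M)))

-- The quantum position ps (game tree cut at any depth b ≥ maxL ps) has Grundy value
-- maxL ps ∸ 1: its options have values maxL (applyQ S ps) ∸ 1 < maxL ps ∸ 1, and every
-- smaller value a is reached by the move {M, M ∸ (a + 1)}.
qgameA-grundy : ∀ b ps → maxL ps ≤ b → HasGrundy (qgameA b ps) (maxL ps ∸ 1)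
qgameA-grundy zero ps M≤0 =
  mex (λ ()) (λ a a<M∸1 → contradiction (≤-trans a<M∸1 (∸-monoˡ-≤ 1 M≤0)) λ ())
qgameA-grundy (suc b) ps M≤b+1 = mex options reach
  where
  M = maxL ps
  Q = qmovesA M
  next : List ℕ → Game
  next S = qgameA b (applyQ S ps)
  options : (i : Fin (length Q)) → Σ ℕ λ a → a ≢ M ∸ 1 × HasGrundy (next (lookup Q i)) a
  options i with qmoveA-max-range ps (∈-lookup {xs = Q} i)
  ... | 1≤m , m<M =
    _ , <⇒≢ (∸-monoˡ-< m<M 1≤m) , qgameA-grundy b _ (≤-pred (≤-trans m<M M≤b+1))
  reach : (a : ℕ) → a < M ∸ 1 → Σ (Fin (length Q)) λ i → HasGrundy (next (lookup Q i)) a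
  reach a a<M∸1 = index S∈Q , subst (λ S → HasGrundy (next S) a) (lookup-index S∈Q) value
    where
    suc-below : ∀ N → a < N ∸ 1 → suc a < N
    suc-below (suc N) a<N = s≤s a<N
    a+1<M : suc a < M
    a+1<M = suc-below M a<M∸1
    S = M ∷ (M ∸ suc a) ∷ []
    S∈Q : S ∈ Q
    S∈Q = top-pair-∈-qmovesA (m<n⇒0<n∸m a+1<M) (∸-monoʳ-< (s≤s z≤n) (<⇒≤ a+1<M))
    max≡a+1 : maxL (applyQ S ps) ≡ suc a
    max≡a+1 = qmoveA-max-reach ps (s≤s z≤n) a+1<M
    value : HasGrundy (next S) a
    value = subst (λ c → HasGrundy (next S) (c ∸ 1)) max≡a+1
              (qgameA-grundy b _ (subst (_≤ b) (sym max≡a+1) (≤-pred (≤-trans a+1<M M≤b+1))))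

-- Main theorem.
mainTheorem4 : (is : List ℕ) → 1 ≤ maxL is → QNimA is ≈G nim (maxL is ∸ 1)
mainTheorem4 is _ = grundy-equiv (qgameA-grundy (maxL is) is ≤-refl) (nim-grundy (maxL is ∸ 1))
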